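{- Let $r\geq2$ be an integer and let $\mathbb T_r$ be the (discrete) $r$-regular tree with the graph metric. For every ball $A=\{x\in\mathbb T_r: d(v_0,x)\le d_0\}$ ($v_0$ a vertex, $d_0$ a nonnegative integer), $$|\mathrm{AP}_3(\mathbb T_r;A)|=\left(\frac12+\frac{(r-2)^2}{2r^2}\right)|A|^2+\frac{2(r-2)}{r^2}|A|+\frac{2}{r^2}.$$ Consequently, $$\limsup_{n\to\infty}\frac{\mu_n(\mathbb T_r)}{n^2}\geq\frac12+\frac{(r-2)^2}{2r^2}.$$
   Context: For a metric space $(M,d_M)$, a triple $(a,b,c)\in M^3$ is a 3-term arithmetic progression if $d_M(a,b)=d_M(b,c)=\frac12 d_M(a,c)$ (constant triples included). For finite $A\subseteq M$, $\mathrm{AP}_3(M;A)$ is the set of such triples in $A^3$, and $\mu_n(M):=\max\{|\mathrm{AP}_3(M;A)| : A\subseteq M,\ |A|=n\}$. -}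

module Defs where

open import Data.Nat using (ℕ; zero; suc; _+_; _*_; _∸_; _≤_)
import Data.Nat as ℕ
open import Data.Fin using (Fin)
import Data.Fin as Fin
open import Data.List using (List; []; _∷_; length; filter; sum; map; cartesianProduct)
open import Data.List.Relation.Unary.Unique.Propositional using (Unique)
open import Data.Product using (_×_; _,_; ∃-syntax)
open import Relation.Binary.PropositionalEquality using (_≡_)
open import Relation.Nullary using (Dec; yes; no)
open import Relation.Nullary.Decidable using (_×-dec_)

-- A non-root vertex is the (unique, non-backtracking) path from the root:
-- a first step to one of the r neighbours of the root, followed by a list of
-- steps, each to one of the (r - 1) children (neighbours other than the parent).
-- Thus the root has r neighbours and every other vertex has 1 + (r - 1) = r.
data V (r : ℕ) : Set where
  root : V r
  br   : Fin r → List (Fin (r ∸ 1)) → V r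

depth : ∀ {r} → V r → ℕ
depth root     = 0
depth (br _ l) = suc (length l)

commonPrefix : ∀ {k} → List (Fin k) → List (Fin k) → ℕ
commonPrefix []       _        = 0
commonPrefix (_ ∷ _)  []       = 0
commonPrefix (x ∷ xs) (y ∷ ys) with x Fin.≟ y
... | yes _ = suc (commonPrefix xs ys)
... | no  _ = 0

meetDepth : ∀ {r} → V r → V r → ℕ
meetDepth root       _          = 0
meetDepth (br _ _)   root       = 0
meetDepth (br i l)   (br j m) with i Fin.≟ j
... | yes _ = suc (commonPrefix l m)
... | no  _ = 0

-- the graph metric of the tree: length of the unique geodesic through the meet
dist : ∀ {r} → V r → V r → ℕ
dist x y = (depth x + depth y) ∸ (2 * meetDepth x y)

IsAP : ∀ {r} → V r → V r → V r → Set
IsAP a b c = (dist a b ≡ dist b c) × (2 * dist b c ≡ dist a c)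

isAP? : ∀ {r} (t : V r × V r × V r) → Dec (let (a , b , c) = t in IsAP a b c)
isAP? (a , b , c) = (dist a b ℕ.≟ dist b c) ×-dec (2 * dist b c ℕ.≟ dist a c)

-- |AP_3(T_r; A)| for a finite set A given as a duplicate-free list
apCount : ∀ {r} → List (V r) → ℕ
apCount A = length (filter isAP? (cartesianProduct A (cartesianProduct A A)))

-- "μ_n(T_r) ≥ m": some n-element subset A of T_r has |AP_3(T_r;A)| ≥ m
MuAtLeast : (r n m : ℕ) → Set
MuAtLeast r n m = ∃[ A ] (Unique {A = V r} A × length A ≡ n × m ≤ apCount A)

{-# OPTIONS --safe #-}
module Submission where

-- In a tree, (a , b , c) is a 3-term progression exactly when d(a , c) is even and b is the
-- midpoint of the geodesic from a to c, and d(a , c) is even exactly when a and c lie at depths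
-- of equal parity.  Balls are convex, so a ball containing E vertices at even and O at odd
-- distance from its centre carries E² + O² progressions.  The tree is vertex-transitive
-- (reflections across edges move any vertex to the root), so the ball may be centred at the
-- root.  There the parity class of the boundary sphere has (r - 1) I + 1 elements, I being the
-- size of the other class, and E² + O² becomes the stated quadratic in |A|.  Balls of growing
-- radius give the lim sup bound.

open import Defs
open import Data.Bool using (true; false)
open import Data.Empty using (⊥-elim)
open import Data.Fin using (Fin; punchIn; punchOut)
import Data.Fin as Fin
import Data.Fin.Properties as Fin
open import Data.List
  using (List; []; _∷_; length; map; filter; take; _++_; allFin; cartesianProduct; cartesianProductWith)
open import Data.List.Membership.Propositional using (_∈_)
open import Data.List.Membership.Propositional.Properties
  using ( ∈-filter⁺; ∈-filter⁻; ∈-map⁺; ∈-map⁻; ∈-++⁺ˡ; ∈-++⁺ʳ; ∈-++⁻; ∈-allFin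
        ; ∈-cartesianProduct⁺; ∈-cartesianProduct⁻; ∈-cartesianProductWith⁺; ∈-cartesianProductWith⁻)
open import Data.List.Membership.Propositional.Properties.WithK using (unique∧set⇒bag)
open import Data.List.Properties
  using ( length-map; length-++; length-take; length-tabulate; map-++; map-∘; ∷-injective
        ; filter-all; filter-none; filter-++; ++-identityʳ)
open import Data.List.Relation.Binary.BagAndSetEquality using (∼bag⇒↭)
open import Data.List.Relation.Binary.Permutation.Propositional.Properties using (↭-length)
open import Data.List.Relation.Unary.All as All using ([])
open import Data.List.Relation.Unary.Any using (here)
open import Data.List.Relation.Unary.Unique.Propositional using (Unique; []; _∷_)
import Data.List.Relation.Unary.Unique.Propositional.Properties as Unique
open import Data.Nat
  using (ℕ; zero; suc; _+_; _*_; _∸_; _^_; _≤_; _<_; _⊓_; _⊔_; z≤n; s≤s; parity; ⌊_/2⌋)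
open import Data.Nat.Properties
open import Data.Nat.Tactic.RingSolver using (solve-∀)
open import Data.Parity using (0ℙ; 1ℙ)
import Data.Parity as ℙ
import Data.Parity.Properties as ℙ
open import Data.Product using (_×_; _,_; proj₁; proj₂; uncurry; ∃-syntax)
import Data.Product as Product
open import Data.Sum using (_⊎_; inj₁; inj₂; swap; [_,_])
open import Data.Sum.Properties using (swap-involutive)
open import Function using (_∘_; id)
open import Function.Bundles using (_⇔_; mk⇔; Equivalence)
open import Level using (Level)
open import Relation.Binary.PropositionalEquality
  using (_≡_; _≢_; refl; sym; trans; cong; cong₂; subst; module ≡-Reasoning)
open import Relation.Nullary using (yes; no; does; ¬_)
open import Relation.Unary using (Pred; Decidable)

open Equivalence using (to; from)

private variable
  ℓ₁ ℓ₂ ℓ₃ ℓ₄ : Level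
  A : Set ℓ₁
  B : Set ℓ₂
  C : Set ℓ₃
  D : Set ℓ₄
  r : ℕ

unique∧set⇒length≡ : {xs ys : List A} → Unique xs → Unique ys →
  (∀ {x} → x ∈ xs ⇔ x ∈ ys) → length xs ≡ length ys
unique∧set⇒length≡ uxs uys same = ↭-length (∼bag⇒↭ (unique∧set⇒bag uxs uys same))

length-cartesianProductWith : (f : A → B → C) (xs : List A) (ys : List B) →
  length (cartesianProductWith f xs ys) ≡ length xs * length ys
length-cartesianProductWith f []       ys = refl
length-cartesianProductWith f (x ∷ xs) ys = begin
  length (map (f x) ys ++ cartesianProductWith f xs ys)
    ≡⟨ length-++ (map (f x) ys) ⟩
  length (map (f x) ys) + length (cartesianProductWith f xs ys)
    ≡⟨ cong₂ _+_ (length-map (f x) ys) (length-cartesianProductWith f xs ys) ⟩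
  length ys + length xs * length ys ∎
  where open ≡-Reasoning

cartesianProduct-map : (f : A → C) (g : B → D) (xs : List A) (ys : List B) →
  cartesianProduct (map f xs) (map g ys) ≡ map (Product.map f g) (cartesianProduct xs ys)
cartesianProduct-map f g []       ys = refl
cartesianProduct-map f g (x ∷ xs) ys = begin
  map (f x ,_) (map g ys) ++ cartesianProduct (map f xs) (map g ys)
    ≡⟨ cong₂ _++_ (sym (map-∘ ys)) (cartesianProduct-map f g xs ys) ⟩
  map (f×g ∘ (x ,_)) ys ++ map f×g (cartesianProduct xs ys)
    ≡⟨ cong (_++ map f×g (cartesianProduct xs ys)) (map-∘ ys) ⟩
  map f×g (map (x ,_) ys) ++ map f×g (cartesianProduct xs ys)
    ≡⟨ map-++ f×g (map (x ,_) ys) _ ⟨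
  map f×g (cartesianProduct (x ∷ xs) ys) ∎
  where
  open ≡-Reasoning
  f×g = Product.map f g

length-filter-map : ∀ {p q} {P : Pred B p} {Q : Pred A q} (P? : Decidable P) (Q? : Decidable Q)
  (f : A → B) → (∀ x → does (P? (f x)) ≡ does (Q? x)) →
  ∀ xs → length (filter P? (map f xs)) ≡ length (filter Q? xs)
length-filter-map P? Q? f same []       = refl
length-filter-map P? Q? f same (x ∷ xs) with does (P? (f x)) | does (Q? x) | same x
... | true  | .true  | refl = cong suc (length-filter-map P? Q? f same xs)
... | false | .false | refl = length-filter-map P? Q? f same xs

even⇒2*⌊n/2⌋≡n : ∀ n → parity n ≡ 0ℙ → 2 * ⌊ n /2⌋ ≡ n
even⇒2*⌊n/2⌋≡n zero          _    = refl
even⇒2*⌊n/2⌋≡n (suc (suc n)) even =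
  cong suc (trans (+-suc ⌊ n /2⌋ (⌊ n /2⌋ + 0)) (cong suc (even⇒2*⌊n/2⌋≡n n even)))

⌊2*n/2⌋≡n : ∀ n → ⌊ 2 * n /2⌋ ≡ n
⌊2*n/2⌋≡n n = sym (trans (n≡⌊n+n/2⌋ n) (cong (λ m → ⌊ n + m /2⌋) (sym (+-identityʳ n))))

+≡0ℙ⇔≡ : ∀ p q → p ℙ.+ q ≡ 0ℙ ⇔ p ≡ q
+≡0ℙ⇔≡ 0ℙ 0ℙ = mk⇔ (λ _ → refl) (λ _ → refl)
+≡0ℙ⇔≡ 0ℙ 1ℙ = mk⇔ (λ ()) (λ ())
+≡0ℙ⇔≡ 1ℙ 0ℙ = mk⇔ (λ ()) (λ ())
+≡0ℙ⇔≡ 1ℙ 1ℙ = mk⇔ (λ _ → refl) (λ _ → refl)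

parity-dichotomy : ∀ p n → p ≡ parity n ⊎ p ≡ parity (suc n)
parity-dichotomy 0ℙ zero          = inj₁ refl
parity-dichotomy 1ℙ zero          = inj₂ refl
parity-dichotomy 0ℙ (suc zero)    = inj₂ refl
parity-dichotomy 1ℙ (suc zero)    = inj₁ refl
parity-dichotomy p  (suc (suc n)) = parity-dichotomy p n

parity≢parity-suc : ∀ n → parity n ≢ parity (suc n)
parity≢parity-suc zero          ()
parity≢parity-suc (suc zero)    ()
parity≢parity-suc (suc (suc n)) = parity≢parity-suc n

-- The rooted tree: depth, meet and distance

module _ {k : ℕ} where

  commonPrefix-∷≡ : ∀ x (xs ys : List (Fin k)) → commonPrefix (x ∷ xs) (x ∷ ys) ≡ suc (commonPrefix xs ys)
  commonPrefix-∷≡ x xs ys with x Fin.≟ x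
  ... | yes _   = refl
  ... | no  x≢x = ⊥-elim (x≢x refl)

  commonPrefix-∷≢ : ∀ {x y} (xs ys : List (Fin k)) → x ≢ y → commonPrefix (x ∷ xs) (y ∷ ys) ≡ 0
  commonPrefix-∷≢ {x} {y} xs ys x≢y with x Fin.≟ y
  ... | yes x≡y = ⊥-elim (x≢y x≡y)
  ... | no  _   = refl

  commonPrefix-comm : (xs ys : List (Fin k)) → commonPrefix xs ys ≡ commonPrefix ys xs
  commonPrefix-comm []       []       = refl
  commonPrefix-comm []       (_ ∷ _)  = refl
  commonPrefix-comm (_ ∷ _)  []       = refl
  commonPrefix-comm (x ∷ xs) (y ∷ ys) with x Fin.≟ y | y Fin.≟ x
  ... | yes _   | yes _   = cong suc (commonPrefix-comm xs ys)
  ... | no  _   | no  _   = refl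
  ... | yes x≡y | no  y≢x = ⊥-elim (y≢x (sym x≡y))
  ... | no  x≢y | yes y≡x = ⊥-elim (x≢y (sym y≡x))

  commonPrefix≤length : (xs ys : List (Fin k)) → commonPrefix xs ys ≤ length xs
  commonPrefix≤length []       _        = z≤n
  commonPrefix≤length (_ ∷ _)  []       = z≤n
  commonPrefix≤length (x ∷ xs) (y ∷ ys) with x Fin.≟ y
  ... | yes _ = s≤s (commonPrefix≤length xs ys)
  ... | no  _ = z≤n

  commonPrefix-self : (xs : List (Fin k)) → commonPrefix xs xs ≡ length xs
  commonPrefix-self []       = refl
  commonPrefix-self (x ∷ xs) = trans (commonPrefix-∷≡ x xs xs) (cong suc (commonPrefix-self xs))

  commonPrefix-take : ∀ n (xs ys : List (Fin k)) → commonPrefix xs (take n ys) ≡ n ⊓ commonPrefix xs ys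
  commonPrefix-take zero    []       ys       = refl
  commonPrefix-take zero    (_ ∷ _)  ys       = refl
  commonPrefix-take (suc n) []       ys       = refl
  commonPrefix-take (suc n) (_ ∷ _)  []       = refl
  commonPrefix-take (suc n) (x ∷ xs) (y ∷ ys) with x Fin.≟ y
  ... | yes _ = cong suc (commonPrefix-take n xs ys)
  ... | no  _ = refl

  commonPrefix≡length⇒prefix : (xs ys : List (Fin k)) →
    commonPrefix xs ys ≡ length xs → xs ≡ take (length xs) ys
  commonPrefix≡length⇒prefix []       ys       _  = refl
  commonPrefix≡length⇒prefix (x ∷ xs) []       ()
  commonPrefix≡length⇒prefix (x ∷ xs) (y ∷ ys) eq with x Fin.≟ y
  ... | yes refl = cong (x ∷_) (commonPrefix≡length⇒prefix xs ys (suc-injective eq))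
  ... | no  _    with () ← eq

ancestor : ℕ → V r → V r
ancestor zero    _        = root
ancestor (suc n) root     = root
ancestor (suc n) (br i l) = br i (take n l)

meetDepth-br≡ : ∀ (i : Fin r) l m → meetDepth (br i l) (br i m) ≡ suc (commonPrefix l m)
meetDepth-br≡ i l m with i Fin.≟ i
... | yes _   = refl
... | no  i≢i = ⊥-elim (i≢i refl)

meetDepth-br≢ : ∀ {i j : Fin r} l m → i ≢ j → meetDepth (br i l) (br j m) ≡ 0
meetDepth-br≢ {i = i} {j} l m i≢j with i Fin.≟ j
... | yes i≡j = ⊥-elim (i≢j i≡j)
... | no  _   = refl

meetDepth-comm : (x y : V r) → meetDepth x y ≡ meetDepth y x
meetDepth-comm root     root     = refl
meetDepth-comm root     (br _ _) = refl
meetDepth-comm (br _ _) root     = refl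
meetDepth-comm (br i l) (br j m) with i Fin.≟ j | j Fin.≟ i
... | yes _   | yes _   = cong suc (commonPrefix-comm l m)
... | no  _   | no  _   = refl
... | yes i≡j | no  j≢i = ⊥-elim (j≢i (sym i≡j))
... | no  i≢j | yes j≡i = ⊥-elim (i≢j (sym j≡i))

meetDepth≤depth : (x y : V r) → meetDepth x y ≤ depth x
meetDepth≤depth root     _        = z≤n
meetDepth≤depth (br _ _) root     = z≤n
meetDepth≤depth (br i l) (br j m) with i Fin.≟ j
... | yes _ = s≤s (commonPrefix≤length l m)
... | no  _ = z≤n

meetDepth-self : (x : V r) → meetDepth x x ≡ depth x
meetDepth-self root     = refl
meetDepth-self (br i l) = trans (meetDepth-br≡ i l l) (cong suc (commonPrefix-self l))

meetDepth-ancestor : ∀ n (x y : V r) → meetDepth x (ancestor n y) ≡ n ⊓ meetDepth x y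
meetDepth-ancestor zero    root     _        = refl
meetDepth-ancestor zero    (br _ _) _        = refl
meetDepth-ancestor (suc n) root     _        = refl
meetDepth-ancestor (suc n) (br _ _) root     = refl
meetDepth-ancestor (suc n) (br i l) (br j m) with i Fin.≟ j
... | yes _ = cong suc (commonPrefix-take n l m)
... | no  _ = refl

depth-ancestor : ∀ n (x : V r) → n ≤ depth x → depth (ancestor n x) ≡ n
depth-ancestor zero    _        _         = refl
depth-ancestor (suc n) (br i l) (s≤s n≤l) = cong suc (trans (length-take n l) (m≤n⇒m⊓n≡m n≤l))

meetDepth≡depth⇒ancestor : (x y : V r) → meetDepth x y ≡ depth x → x ≡ ancestor (depth x) y
meetDepth≡depth⇒ancestor root     _        _  = refl
meetDepth≡depth⇒ancestor (br _ _) root     ()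
meetDepth≡depth⇒ancestor (br i l) (br j m) eq with i Fin.≟ j
... | yes refl = cong (br i) (commonPrefix≡length⇒prefix l m (suc-injective eq))
... | no  _    with () ← eq

dist+2*meetDepth : (x y : V r) → dist x y + 2 * meetDepth x y ≡ depth x + depth y
dist+2*meetDepth x y =
  m∸n+n≡m (+-mono-≤ (meetDepth≤depth x y) (≤-trans (≤-reflexive (+-identityʳ _)) meetDepth≤depthʳ))
  where
  meetDepth≤depthʳ : meetDepth x y ≤ depth y
  meetDepth≤depthʳ = subst (_≤ depth y) (meetDepth-comm y x) (meetDepth≤depth y x)

dist-comm : (x y : V r) → dist x y ≡ dist y x
dist-comm x y = cong₂ _∸_ (+-comm (depth x) (depth y)) (cong (2 *_) (meetDepth-comm x y))

parity-dist : (x y : V r) → parity (dist x y) ≡ parity (depth x) ℙ.+ parity (depth y)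
parity-dist x y = begin
  parity (dist x y)                                ≡⟨ ℙ.+-identityʳ _ ⟨
  parity (dist x y) ℙ.+ 0ℙ                         ≡⟨ cong (parity (dist x y) ℙ.+_) parity-2*meet ⟨
  parity (dist x y) ℙ.+ parity (2 * meetDepth x y) ≡⟨ ℙ.+-homo-+ (dist x y) _ ⟨
  parity (dist x y + 2 * meetDepth x y)            ≡⟨ cong parity (dist+2*meetDepth x y) ⟩
  parity (depth x + depth y)                       ≡⟨ ℙ.+-homo-+ (depth x) (depth y) ⟩
  parity (depth x) ℙ.+ parity (depth y)            ∎
  where
  open ≡-Reasoning
  parity-2*meet : parity (2 * meetDepth x y) ≡ 0ℙ
  parity-2*meet = ℙ.*-homo-* 2 (meetDepth x y)

evenDist⇔sameParity : (a c : V r) → parity (dist a c) ≡ 0ℙ ⇔ parity (depth a) ≡ parity (depth c)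
evenDist⇔sameParity a c =
  subst (λ p → p ≡ 0ℙ ⇔ parity (depth a) ≡ parity (depth c)) (sym (parity-dist a c))
        (+≡0ℙ⇔≡ (parity (depth a)) (parity (depth c)))

dist-ancestor+2*⊓ : ∀ n (z y : V r) → n ≤ depth y →
  dist z (ancestor n y) + 2 * (n ⊓ meetDepth z y) ≡ depth z + n
dist-ancestor+2*⊓ n z y n≤depth = begin
  dist z t + 2 * (n ⊓ meetDepth z y) ≡⟨ cong (λ m → dist z t + 2 * m) (meetDepth-ancestor n z y) ⟨
  dist z t + 2 * meetDepth z t       ≡⟨ dist+2*meetDepth z t ⟩
  depth z + depth t                  ≡⟨ cong (depth z +_) (depth-ancestor n y n≤depth) ⟩
  depth z + n                        ∎
  where
  open ≡-Reasoning
  t = ancestor n y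

dist-ancestor≤ : ∀ n (z y : V r) → n ≤ depth y → dist z (ancestor n y) ≤ depth z ⊔ dist z y
dist-ancestor≤ n z y n≤depth with ≤-total n (meetDepth z y)
... | inj₁ n≤h = m≤n⇒m≤n⊔o (dist z y) (+-cancelʳ-≤ n _ _ (begin
  dist z t + n                       ≤⟨ +-monoʳ-≤ (dist z t) (m≤m+n n (n + 0)) ⟩
  dist z t + 2 * n                   ≡⟨ cong (λ m → dist z t + 2 * m) (m≤n⇒m⊓n≡m n≤h) ⟨
  dist z t + 2 * (n ⊓ meetDepth z y) ≡⟨ dist-ancestor+2*⊓ n z y n≤depth ⟩
  depth z + n                        ∎))
  where
  open ≤-Reasoning
  t = ancestor n y
... | inj₂ h≤n = m≤n⇒m≤o⊔n (depth z) (+-cancelʳ-≤ (2 * meetDepth z y) _ _ (begin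
  dist z t + 2 * meetDepth z y       ≡⟨ cong (λ m → dist z t + 2 * m) (m≥n⇒m⊓n≡n h≤n) ⟨
  dist z t + 2 * (n ⊓ meetDepth z y) ≡⟨ dist-ancestor+2*⊓ n z y n≤depth ⟩
  depth z + n                        ≤⟨ +-monoʳ-≤ (depth z) n≤depth ⟩
  depth z + depth y                  ≡⟨ dist+2*meetDepth z y ⟨
  dist z y + 2 * meetDepth z y       ∎))
  where
  open ≤-Reasoning
  t = ancestor n y

IsAP-root⇒ancestor : (b c : V r) → IsAP root b c → depth c ≡ 2 * depth b × b ≡ ancestor (depth b) c
IsAP-root⇒ancestor b c (depth-b≡ , 2*bc≡) = depth-c , meetDepth≡depth⇒ancestor b c meet≡depth
  where
  depth-c : depth c ≡ 2 * depth b
  depth-c = trans (sym 2*bc≡) (cong (2 *_) (sym depth-b≡))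
  meet≡depth : meetDepth b c ≡ depth b
  meet≡depth = *-cancelˡ-≡ _ _ 2 (+-cancelˡ-≡ (depth b) _ _ (begin
    depth b + 2 * meetDepth b c  ≡⟨ cong (_+ 2 * meetDepth b c) depth-b≡ ⟩
    dist b c + 2 * meetDepth b c ≡⟨ dist+2*meetDepth b c ⟩
    depth b + depth c            ≡⟨ cong (depth b +_) depth-c ⟩
    depth b + 2 * depth b        ∎))
    where open ≡-Reasoning

ancestor-IsAP-root : ∀ n (c : V r) → depth c ≡ 2 * n → IsAP root (ancestor n c) c
ancestor-IsAP-root n c depth-c = trans depth-t (sym dist≡n) , trans (cong (2 *_) dist≡n) (sym depth-c)
  where
  t = ancestor n c
  n≤depth : n ≤ depth c
  n≤depth = ≤-trans (m≤m+n n (n + 0)) (≤-reflexive (sym depth-c))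
  depth-t : depth t ≡ n
  depth-t = depth-ancestor n c n≤depth
  n⊓meet≡n : n ⊓ meetDepth c c ≡ n
  n⊓meet≡n = trans (cong (n ⊓_) (meetDepth-self c)) (m≤n⇒m⊓n≡m n≤depth)
  dist≡n : dist t c ≡ n
  dist≡n = trans (dist-comm t c) (+-cancelʳ-≡ (2 * n) _ _ (begin
    dist c t + 2 * n                   ≡⟨ cong (λ m → dist c t + 2 * m) n⊓meet≡n ⟨
    dist c t + 2 * (n ⊓ meetDepth c c) ≡⟨ dist-ancestor+2*⊓ n c c n≤depth ⟩
    depth c + n                        ≡⟨ cong (_+ n) depth-c ⟩
    2 * n + n                          ≡⟨ +-comm (2 * n) n ⟩
    n + 2 * n                          ∎))
    where open ≡-Reasoning

-- Reflections across edges, and vertex-transitivity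

wordDist : List (Fin r) → List (Fin r) → ℕ
wordDist l m = (length l + length m) ∸ 2 * commonPrefix l m

-- Deleting the edge between root and br i [] leaves two copies of the word tree over Fin r,
-- rooted at root (inj₁) and at br i [] (inj₂); swapping them reflects the tree across that edge.
cut : Fin (suc r) → V (suc r) → List (Fin r) ⊎ List (Fin r)
cut i root = inj₁ []
cut i (br j l) with i Fin.≟ j
... | yes _   = inj₂ l
... | no  i≢j = inj₁ (punchOut i≢j ∷ l)

glue : Fin (suc r) → List (Fin r) ⊎ List (Fin r) → V (suc r)
glue i (inj₁ [])      = root
glue i (inj₁ (j ∷ l)) = br (punchIn i j) l
glue i (inj₂ l)       = br i l

cutDist : List (Fin r) ⊎ List (Fin r) → List (Fin r) ⊎ List (Fin r) → ℕ
cutDist (inj₁ l) (inj₁ m) = wordDist l m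
cutDist (inj₂ l) (inj₂ m) = wordDist l m
cutDist (inj₁ l) (inj₂ m) = suc (length l + length m)
cutDist (inj₂ l) (inj₁ m) = suc (length l + length m)

cut-br : ∀ (i : Fin (suc r)) l → cut i (br i l) ≡ inj₂ l
cut-br i l with i Fin.≟ i
... | yes _   = refl
... | no  i≢i = ⊥-elim (i≢i refl)

glue-cut : ∀ i (x : V (suc r)) → glue i (cut i x) ≡ x
glue-cut i root = refl
glue-cut i (br j l) with i Fin.≟ j
... | yes refl = refl
... | no  i≢j  = cong (λ k → br k l) (Fin.punchIn-punchOut i≢j)

cut-glue : ∀ i (s : List (Fin r) ⊎ List (Fin r)) → cut i (glue i s) ≡ s
cut-glue i (inj₁ [])      = refl
cut-glue i (inj₁ (j ∷ l)) with i Fin.≟ punchIn i j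
... | yes i≡ = ⊥-elim (Fin.punchInᵢ≢i i j (sym i≡))
... | no  _  = cong (λ k → inj₁ (k ∷ l)) (trans (Fin.punchOut-cong i refl) (Fin.punchOut-punchIn i))
cut-glue i (inj₂ l)       = cut-br i l

dist-br : ∀ {i j : Fin r} l m {h} → meetDepth (br i l) (br j m) ≡ h →
  dist (br i l) (br j m) ≡ (suc (length l) + suc (length m)) ∸ 2 * h
dist-br l m = cong (λ h → (suc (length l) + suc (length m)) ∸ 2 * h)

dist-br-br : ∀ (i : Fin r) l m → dist (br i l) (br i m) ≡ wordDist l m
dist-br-br i l m = begin
  dist (br i l) (br i m)                              ≡⟨ dist-br l m (meetDepth-br≡ i l m) ⟩
  (suc (length l) + suc (length m)) ∸ 2 * suc c       ≡⟨ cong₂ _∸_ (cong suc (+-suc (length l) (length m)))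
                                                                   (cong suc (+-suc c (c + 0))) ⟩
  (2 + (length l + length m)) ∸ (2 + 2 * c)           ≡⟨ [m+n]∸[m+o]≡n∸o 2 (length l + length m) (2 * c) ⟩
  wordDist l m                                        ∎
  where
  open ≡-Reasoning
  c = commonPrefix l m

meetDepth-outside : ∀ {i j k : Fin (suc r)} (i≢j : i ≢ j) (i≢k : i ≢ k) l m →
  meetDepth (br j l) (br k m) ≡ commonPrefix (punchOut i≢j ∷ l) (punchOut i≢k ∷ m)
meetDepth-outside {i = i} {j} {k} i≢j i≢k l m with j Fin.≟ k
... | yes refl = sym (trans (cong (λ p → commonPrefix (p ∷ l) (punchOut i≢k ∷ m)) (Fin.punchOut-cong i refl))
                            (commonPrefix-∷≡ (punchOut i≢k) l m))
... | no  j≢k  = sym (commonPrefix-∷≢ l m (j≢k ∘ Fin.punchOut-injective i≢j i≢k))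

dist-cut : ∀ i (x y : V (suc r)) → dist x y ≡ cutDist (cut i x) (cut i y)
dist-cut i root     root     = refl
dist-cut i root     (br k m) with i Fin.≟ k
... | yes _ = refl
... | no  _ = refl
dist-cut i (br j l) root     with i Fin.≟ j
... | yes _ = refl
... | no  _ = refl
dist-cut i (br j l) (br k m) with i Fin.≟ j | i Fin.≟ k
... | yes refl | yes refl = dist-br-br i l m
... | yes refl | no  i≢k  = dist-br l m (meetDepth-br≢ l m i≢k)
... | no  i≢j  | yes refl =
  trans (dist-br l m (meetDepth-br≢ l m (i≢j ∘ sym))) (cong suc (+-suc (length l) (length m)))
... | no  i≢j  | no  i≢k  = dist-br l m (meetDepth-outside i≢j i≢k l m)

cutDist-swap : (s t : List (Fin r) ⊎ List (Fin r)) → cutDist (swap s) (swap t) ≡ cutDist s t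
cutDist-swap (inj₁ _) (inj₁ _) = refl
cutDist-swap (inj₁ _) (inj₂ _) = refl
cutDist-swap (inj₂ _) (inj₁ _) = refl
cutDist-swap (inj₂ _) (inj₂ _) = refl

reflect : Fin (suc r) → V (suc r) → V (suc r)
reflect i = glue i ∘ swap ∘ cut i

reflect-involutive : ∀ i (x : V (suc r)) → reflect i (reflect i x) ≡ x
reflect-involutive i x = begin
  glue i (swap (cut i (glue i (swap (cut i x))))) ≡⟨ cong (glue i ∘ swap) (cut-glue i (swap (cut i x))) ⟩
  glue i (swap (swap (cut i x)))                  ≡⟨ cong (glue i) (swap-involutive (cut i x)) ⟩
  glue i (cut i x)                                ≡⟨ glue-cut i x ⟩
  x                                               ∎
  where open ≡-Reasoning

dist-reflect : ∀ i (x y : V (suc r)) → dist (reflect i x) (reflect i y) ≡ dist x y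
dist-reflect i x y = begin
  dist (reflect i x) (reflect i y)                    ≡⟨ dist-cut i (reflect i x) (reflect i y) ⟩
  cutDist (cut i (reflect i x)) (cut i (reflect i y)) ≡⟨ cong₂ cutDist (cut-glue i (swap (cut i x)))
                                                                       (cut-glue i (swap (cut i y))) ⟩
  cutDist (swap (cut i x)) (swap (cut i y))           ≡⟨ cutDist-swap (cut i x) (cut i y) ⟩
  cutDist (cut i x) (cut i y)                         ≡⟨ dist-cut i x y ⟨
  dist x y                                            ∎
  where open ≡-Reasoning

reflect-neighbour : ∀ (i : Fin (suc r)) → reflect i (br i []) ≡ root
reflect-neighbour i = cong (glue i ∘ swap) (cut-br i [])

reflect-child : ∀ (i : Fin (suc r)) j l → reflect i (br i (j ∷ l)) ≡ br (punchIn i j) l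
reflect-child i j l = cong (glue i ∘ swap) (cut-br i (j ∷ l))

record Isometry (r : ℕ) : Set where
  field
    apply   : V r → V r
    unapply : V r → V r
    apply-unapply : ∀ x → apply (unapply x) ≡ x
    unapply-apply : ∀ x → unapply (apply x) ≡ x
    dist-apply    : ∀ x y → dist (apply x) (apply y) ≡ dist x y

open Isometry

idᴵ : Isometry r
idᴵ = record
  { apply = id ; unapply = id
  ; apply-unapply = λ _ → refl ; unapply-apply = λ _ → refl ; dist-apply = λ _ _ → refl }

_∘ᴵ_ : Isometry r → Isometry r → Isometry r
g ∘ᴵ f = record
  { apply         = apply g ∘ apply f
  ; unapply       = unapply f ∘ unapply g
  ; apply-unapply = λ x → trans (cong (apply g) (apply-unapply f (unapply g x))) (apply-unapply g x)
  ; unapply-apply = λ x → trans (cong (unapply f) (unapply-apply g (apply f x))) (unapply-apply f x)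
  ; dist-apply    = λ x y → trans (dist-apply g (apply f x) (apply f y)) (dist-apply f x y)
  }

reflectᴵ : Fin (suc r) → Isometry (suc r)
reflectᴵ i = record
  { apply = reflect i ; unapply = reflect i
  ; apply-unapply = reflect-involutive i ; unapply-apply = reflect-involutive i ; dist-apply = dist-reflect i }

recentreBranch : Fin (suc r) → List (Fin r) → Isometry (suc r)
recentreBranch i []      = reflectᴵ i
recentreBranch i (j ∷ l) = recentreBranch (punchIn i j) l ∘ᴵ reflectᴵ i

recentreBranch-centre : ∀ (i : Fin (suc r)) l → apply (recentreBranch i l) (br i l) ≡ root
recentreBranch-centre i []      = reflect-neighbour i
recentreBranch-centre i (j ∷ l) = trans (cong (apply (recentreBranch (punchIn i j) l)) (reflect-child i j l))
                                        (recentreBranch-centre (punchIn i j) l)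

recentre : V (suc r) → Isometry (suc r)
recentre root     = idᴵ
recentre (br i l) = recentreBranch i l

recentre-centre : (v : V (suc r)) → apply (recentre v) v ≡ root
recentre-centre root     = refl
recentre-centre (br i l) = recentreBranch-centre i l

depth-apply : (f : Isometry r) {v : V r} → apply f v ≡ root → ∀ y → depth (apply f y) ≡ dist v y
depth-apply f {v} fv≡root y = trans (cong (λ z → dist z (apply f y)) (sym fv≡root)) (dist-apply f v y)

module _ (g : V r → V r) (isometric : ∀ x y → dist (g x) (g y) ≡ dist x y) where

  IsAP-isometric : ∀ a b c → IsAP (g a) (g b) (g c) ⇔ IsAP a b c
  IsAP-isometric a b c rewrite isometric a b | isometric b c | isometric a c = mk⇔ id id

  apCount-map : ∀ A → apCount (map g A) ≡ apCount A
  apCount-map A = begin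
    length (filter isAP? (cartesianProduct (map g A) (cartesianProduct (map g A) (map g A))))
      ≡⟨ cong (λ xs → length (filter isAP? (cartesianProduct (map g A) xs))) (cartesianProduct-map g g A A) ⟩
    length (filter isAP? (cartesianProduct (map g A) (map g² (cartesianProduct A A))))
      ≡⟨ cong (length ∘ filter isAP?) (cartesianProduct-map g g² A (cartesianProduct A A)) ⟩
    length (filter isAP? (map g³ (cartesianProduct A (cartesianProduct A A))))
      ≡⟨ length-filter-map isAP? isAP? g³ same-decision (cartesianProduct A (cartesianProduct A A)) ⟩
    apCount A ∎
    where
    open ≡-Reasoning
    g² = Product.map g g
    g³ = Product.map g g²
    same-decision : ∀ t → does (isAP? (g³ t)) ≡ does (isAP? t)
    same-decision (a , b , c) rewrite isometric a b | isometric b c | isometric a c = refl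

-- Recentred at a, the vertex a becomes root, and the midpoint of root and a vertex at even
-- depth 2k is its ancestor at depth k.  For odd d(a , c) the value is junk.
midpoint : V (suc r) → V (suc r) → V (suc r)
midpoint a c = unapply f (ancestor ⌊ dist a c /2⌋ (apply f c))
  where f = recentre a

module _ (a c : V (suc r)) where
  private
    f = recentre a
    K = ⌊ dist a c /2⌋

    depth-c : depth (apply f c) ≡ dist a c
    depth-c = depth-apply f (recentre-centre a) c

    IsAP-recentre : ∀ b → IsAP root (apply f b) (apply f c) ⇔ IsAP a b c
    IsAP-recentre b = subst (λ z → IsAP z (apply f b) (apply f c) ⇔ IsAP a b c) (recentre-centre a)
                            (IsAP-isometric (apply f) (dist-apply f) a b c)

  IsAP⇒midpoint : ∀ b → IsAP a b c → parity (dist a c) ≡ 0ℙ × b ≡ midpoint a c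
  IsAP⇒midpoint b ap
    with depth-c≡ , fb≡ancestor ← IsAP-root⇒ancestor (apply f b) (apply f c) (from (IsAP-recentre b) ap)
    = parity-even , b≡midpoint
    where
    dist≡ : dist a c ≡ 2 * depth (apply f b)
    dist≡ = trans (sym depth-c) depth-c≡
    parity-even : parity (dist a c) ≡ 0ℙ
    parity-even = trans (cong parity dist≡) (ℙ.*-homo-* 2 (depth (apply f b)))
    b≡midpoint : b ≡ midpoint a c
    b≡midpoint = begin
      b                                                    ≡⟨ unapply-apply f b ⟨
      unapply f (apply f b)                                ≡⟨ cong (unapply f) fb≡ancestor ⟩
      unapply f (ancestor (depth (apply f b)) (apply f c)) ≡⟨ cong (λ n → unapply f (ancestor n _)) depth≡K ⟩
      midpoint a c                                         ∎
      where
      open ≡-Reasoning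
      depth≡K : depth (apply f b) ≡ K
      depth≡K = trans (sym (⌊2*n/2⌋≡n _)) (cong ⌊_/2⌋ (sym dist≡))

  midpoint-IsAP : parity (dist a c) ≡ 0ℙ → IsAP a (midpoint a c) c
  midpoint-IsAP even = to (IsAP-recentre (midpoint a c))
    (subst (λ z → IsAP root z (apply f c)) (sym (apply-unapply f _))
      (ancestor-IsAP-root K (apply f c) (trans depth-c (sym (even⇒2*⌊n/2⌋≡n (dist a c) even)))))

  depth-midpoint : depth (midpoint a c) ≤ depth a ⊔ depth c
  depth-midpoint = begin
    depth (midpoint a c)                 ≡⟨ dist-apply f root (midpoint a c) ⟨
    dist root′ (apply f (midpoint a c))  ≡⟨ cong (dist root′) (apply-unapply f _) ⟩
    dist root′ (ancestor K (apply f c))  ≤⟨ dist-ancestor≤ K root′ (apply f c) K≤depth ⟩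
    depth root′ ⊔ dist root′ (apply f c) ≡⟨ cong₂ _⊔_ depth-root′ (dist-apply f root c) ⟩
    depth a ⊔ depth c                    ∎
    where
    open ≤-Reasoning
    root′ = apply f root
    K≤depth : K ≤ depth (apply f c)
    K≤depth = ≤-trans (⌊n/2⌋≤n (dist a c)) (≤-reflexive (sym depth-c))
    depth-root′ : depth root′ ≡ depth a
    depth-root′ = trans (depth-apply f (recentre-centre a) root) (dist-comm a root)

-- Counting progressions

parityClass : ℕ → List (V r) → List (V r)
parityClass n = filter (λ x → parity (depth x) ℙ.≟ parity n)

∈-parityClass : ∀ n {A : List (V r)} {x} → x ∈ parityClass n A ⇔ (x ∈ A × parity (depth x) ≡ parity n)
∈-parityClass n = mk⇔ (∈-filter⁻ _) (uncurry (∈-filter⁺ _))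

length-parityClasses : ∀ n (xs : List (V r)) →
  length (parityClass n xs) + length (parityClass (suc n) xs) ≡ length xs
length-parityClasses n []       = refl
length-parityClasses n (x ∷ xs) with parity (depth x) ℙ.≟ parity n | parity (depth x) ℙ.≟ parity (suc n)
... | yes ≡n | yes ≡sn = ⊥-elim (parity≢parity-suc n (trans (sym ≡n) ≡sn))
... | yes _  | no  _   = cong suc (length-parityClasses n xs)
... | no  _  | yes _   = trans (+-suc _ _) (cong suc (length-parityClasses n xs))
... | no  ≢n | no  ≢sn = ⊥-elim ([ ≢n , ≢sn ] (parity-dichotomy (parity (depth x)) n))

length-parityClass-cong : ∀ n {A B : List (V r)} → Unique A → Unique B → (∀ {x} → x ∈ A ⇔ x ∈ B) →
  length (parityClass n A) ≡ length (parityClass n B)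
length-parityClass-cong n uA uB same =
  unique∧set⇒length≡ (Unique.filter⁺ _ uA) (Unique.filter⁺ _ uB)
                     (mk⇔ (restrict (to same)) (restrict (from same)))
  where
  restrict : ∀ {A B x} → (x ∈ A → x ∈ B) → x ∈ parityClass n A → x ∈ parityClass n B
  restrict {A} {B} A⊆B x∈ with x∈A , p ← to (∈-parityClass n {A}) x∈ =
    from (∈-parityClass n {B}) (A⊆B x∈A , p)

squareParityClass : ℕ → List (V r) → List (V r × V r)
squareParityClass n A = cartesianProduct (parityClass n A) (parityClass n A)

∈-squareParityClass : ∀ n {A : List (V r)} {a c} → (a , c) ∈ squareParityClass n A ⇔
  ((a ∈ A × parity (depth a) ≡ parity n) × (c ∈ A × parity (depth c) ≡ parity n))
∈-squareParityClass n {A} = mk⇔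
  (Product.map (to (∈-parityClass n {A})) (to (∈-parityClass n {A}))
    ∘ ∈-cartesianProduct⁻ (parityClass n A) (parityClass n A))
  (λ (a∈ , c∈) → ∈-cartesianProduct⁺ (from (∈-parityClass n {A}) a∈) (from (∈-parityClass n {A}) c∈))

sameParityPairs : ℕ → List (V r) → List (V r × V r)
sameParityPairs n A = squareParityClass n A ++ squareParityClass (suc n) A

∈-sameParityPairs : ∀ n {A : List (V r)} {a c} →
  (a , c) ∈ sameParityPairs n A ⇔ (a ∈ A × c ∈ A × parity (depth a) ≡ parity (depth c))
∈-sameParityPairs n {A} {a} {c} = mk⇔ sound complete
  where
  fromSquare : ∀ m → (a , c) ∈ squareParityClass m A →
    a ∈ A × c ∈ A × parity (depth a) ≡ parity (depth c)
  fromSquare m ac∈ with (a∈ , pa) , (c∈ , pc) ← to (∈-squareParityClass m {A}) ac∈ =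
    a∈ , c∈ , trans pa (sym pc)
  sound : (a , c) ∈ sameParityPairs n A → a ∈ A × c ∈ A × parity (depth a) ≡ parity (depth c)
  sound ac∈ = [ fromSquare n , fromSquare (suc n) ] (∈-++⁻ _ ac∈)
  toSquare : ∀ m → a ∈ A → c ∈ A → parity (depth a) ≡ parity (depth c) →
    parity (depth a) ≡ parity m → (a , c) ∈ squareParityClass m A
  toSquare m a∈ c∈ pa≡pc pa≡m =
    from (∈-squareParityClass m {A}) ((a∈ , pa≡m) , (c∈ , trans (sym pa≡pc) pa≡m))
  complete : a ∈ A × c ∈ A × parity (depth a) ≡ parity (depth c) → (a , c) ∈ sameParityPairs n A
  complete (a∈ , c∈ , pa≡pc) with parity-dichotomy (parity (depth a)) n
  ... | inj₁ pa≡n  = ∈-++⁺ˡ (toSquare n a∈ c∈ pa≡pc pa≡n)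
  ... | inj₂ pa≡sn = ∈-++⁺ʳ _ (toSquare (suc n) a∈ c∈ pa≡pc pa≡sn)

sameParityPairs-unique : ∀ n {A : List (V r)} → Unique A → Unique (sameParityPairs n A)
sameParityPairs-unique n {A} uA = Unique.++⁺ (square-unique n) (square-unique (suc n)) disjoint
  where
  square-unique : ∀ m → Unique (squareParityClass m A)
  square-unique m = Unique.cartesianProduct⁺ (Unique.filter⁺ _ uA) (Unique.filter⁺ _ uA)
  parity-a : ∀ {m ac} → ac ∈ squareParityClass m A → parity (depth (proj₁ ac)) ≡ parity m
  parity-a {m} ac∈ = proj₂ (proj₁ (to (∈-squareParityClass m {A}) ac∈))
  disjoint : ∀ {ac} → ¬ (ac ∈ squareParityClass n A × ac ∈ squareParityClass (suc n) A)
  disjoint (∈n , ∈sn) = parity≢parity-suc n (trans (sym (parity-a {n} ∈n)) (parity-a {suc n} ∈sn))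

spread : V (suc r) × V (suc r) → V (suc r) × V (suc r) × V (suc r)
spread (a , c) = a , midpoint a c , c

spread-injective : ∀ {s t : V (suc r) × V (suc r)} → spread s ≡ spread t → s ≡ t
spread-injective eq = cong₂ _,_ (cong proj₁ eq) (cong (proj₂ ∘ proj₂) eq)

-- The progressions in A are exactly the triples spread (a , c) with a, c ∈ A at even distance.
apCount-convex : {A : List (V (suc r))} → Unique A → (∀ {a c} → a ∈ A → c ∈ A → midpoint a c ∈ A) →
  ∀ n → let C = length (parityClass n A); C′ = length (parityClass (suc n) A) in
  apCount A ≡ C * C + C′ * C′
apCount-convex {A = A} uA convex n = begin
  apCount A
    ≡⟨ unique∧set⇒length≡ (Unique.filter⁺ isAP? triples-unique)
                          (Unique.map⁺ spread-injective (sameParityPairs-unique n uA))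
                          same-members ⟩
  length (map spread (sameParityPairs n A))
    ≡⟨ length-map spread (sameParityPairs n A) ⟩
  length (squareParityClass n A ++ squareParityClass (suc n) A)
    ≡⟨ length-++ (squareParityClass n A) ⟩
  length (squareParityClass n A) + length (squareParityClass (suc n) A)
    ≡⟨ cong₂ _+_ (length-cartesianProductWith _,_ (parityClass n A) (parityClass n A))
                (length-cartesianProductWith _,_ (parityClass (suc n) A) (parityClass (suc n) A)) ⟩
  _ ∎
  where
  open ≡-Reasoning
  triples = cartesianProduct A (cartesianProduct A A)
  triples-unique : Unique triples
  triples-unique = Unique.cartesianProduct⁺ uA (Unique.cartesianProduct⁺ uA uA)
  progression⇒spread : ∀ {a b c} → (a , b , c) ∈ filter isAP? triples →
    (a , b , c) ∈ map spread (sameParityPairs n A)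
  progression⇒spread {a} {b} {c} t∈ with t∈A³ , ap ← ∈-filter⁻ isAP? t∈
    with a∈ , bc∈ ← ∈-cartesianProduct⁻ A (cartesianProduct A A) t∈A³
    with even , refl ← IsAP⇒midpoint a c b ap
    = ∈-map⁺ spread (from (∈-sameParityPairs n)
        (a∈ , proj₂ (∈-cartesianProduct⁻ A A bc∈) , to (evenDist⇔sameParity a c) even))
  spread⇒progression : ∀ {t} → t ∈ map spread (sameParityPairs n A) → t ∈ filter isAP? triples
  spread⇒progression t∈ with (a , c) , ac∈ , refl ← ∈-map⁻ spread t∈
    with a∈ , c∈ , same ← to (∈-sameParityPairs n) ac∈
    = ∈-filter⁺ isAP? (∈-cartesianProduct⁺ a∈ (∈-cartesianProduct⁺ (convex a∈ c∈) c∈))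
                      (midpoint-IsAP a c (from (evenDist⇔sameParity a c) same))
  same-members : ∀ {t} → t ∈ filter isAP? triples ⇔ t ∈ map spread (sameParityPairs n A)
  same-members {_ , _ , _} = mk⇔ progression⇒spread spread⇒progression

-- Spheres and balls about the root

module _ {k : ℕ} where

  words : ℕ → List (List (Fin k))
  words zero    = [] ∷ []
  words (suc n) = cartesianProductWith _∷_ (allFin k) (words n)

  ∈-words : ∀ n {l : List (Fin k)} → l ∈ words n ⇔ length l ≡ n
  ∈-words n = mk⇔ (sound n) (λ { refl → complete _ })
    where
    complete : (l : List (Fin k)) → l ∈ words (length l)
    complete []      = here refl
    complete (i ∷ l) = ∈-cartesianProductWith⁺ _∷_ (∈-allFin i) (complete l)
    sound : ∀ n {l} → l ∈ words n → length l ≡ n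
    sound zero    (here refl) = refl
    sound (suc n) l∈
      with _ , l′ , _ , l′∈ , refl ← ∈-cartesianProductWith⁻ _∷_ (allFin k) (words n) l∈
      = cong suc (sound n l′∈)

  words-unique : ∀ n → Unique (words n)
  words-unique zero    = [] ∷ []
  words-unique (suc n) = Unique.cartesianProductWith⁺ _∷_ ∷-injective (Unique.allFin⁺ k) (words-unique n)

  length-words : ∀ n → length (words n) ≡ k ^ n
  length-words zero    = refl
  length-words (suc n) = trans (length-cartesianProductWith _∷_ (allFin k) (words n))
                               (cong₂ _*_ (length-tabulate {n = k} id) (length-words n))

sphere : ∀ r → ℕ → List (V r)
sphere r zero    = root ∷ []
sphere r (suc n) = cartesianProductWith br (allFin r) (words n)

∈-sphere : ∀ n {x : V r} → x ∈ sphere r n ⇔ depth x ≡ n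
∈-sphere {r} n = mk⇔ (sound n) (λ { refl → complete _ })
  where
  complete : (x : V r) → x ∈ sphere r (depth x)
  complete root     = here refl
  complete (br i l) = ∈-cartesianProductWith⁺ br (∈-allFin i) (from (∈-words (length l)) refl)
  sound : ∀ n {x} → x ∈ sphere r n → depth x ≡ n
  sound zero    (here refl) = refl
  sound (suc n) x∈ with _ , l , _ , l∈ , refl ← ∈-cartesianProductWith⁻ br (allFin r) (words n) x∈
    = cong suc (to (∈-words n) l∈)

sphere-unique : ∀ r n → Unique (sphere r n)
sphere-unique r zero    = [] ∷ []
sphere-unique r (suc n) =
  Unique.cartesianProductWith⁺ br (λ { refl → refl , refl }) (Unique.allFin⁺ r) (words-unique n)

length-sphere : ∀ r n → length (sphere r (suc n)) ≡ r * (r ∸ 1) ^ n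
length-sphere r n = trans (length-cartesianProductWith br (allFin r) (words n))
                          (cong₂ _*_ (length-tabulate {n = r} id) (length-words n))

length-sphere-suc : ∀ r′ d →
  length (sphere (suc r′) (suc (suc d))) ≡ r′ * length (sphere (suc r′) (suc d))
length-sphere-suc r′ d = begin
  length (sphere (suc r′) (suc (suc d))) ≡⟨ length-sphere (suc r′) (suc d) ⟩
  suc r′ * (r′ * r′ ^ d)                 ≡⟨ swap-factors r′ (r′ ^ d) ⟩
  r′ * (suc r′ * r′ ^ d)                 ≡⟨ cong (r′ *_) (length-sphere (suc r′) d) ⟨
  r′ * length (sphere (suc r′) (suc d))  ∎
  where
  open ≡-Reasoning
  swap-factors : ∀ a x → suc a * (a * x) ≡ a * (suc a * x)
  swap-factors = solve-∀

ball : ∀ r → ℕ → List (V r)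
ball r zero    = sphere r zero
ball r (suc d) = ball r d ++ sphere r (suc d)

∈-ball : ∀ d {x : V r} → x ∈ ball r d ⇔ depth x ≤ d
∈-ball {r} d = mk⇔ (sound d) (complete d)
  where
  sound : ∀ d {x} → x ∈ ball r d → depth x ≤ d
  sound zero    x∈ = ≤-reflexive (to (∈-sphere 0) x∈)
  sound (suc d) x∈ =
    [ m≤n⇒m≤1+n ∘ sound d , ≤-reflexive ∘ to (∈-sphere (suc d)) ] (∈-++⁻ (ball r d) x∈)
  complete : ∀ d {x} → depth x ≤ d → x ∈ ball r d
  complete zero    x≤0 = from (∈-sphere 0) (n≤0⇒n≡0 x≤0)
  complete (suc d) x≤  with m≤n⇒m<n∨m≡n x≤
  ... | inj₁ (s≤s x≤d) = ∈-++⁺ˡ (complete d x≤d)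
  ... | inj₂ x≡        = ∈-++⁺ʳ (ball r d) (from (∈-sphere (suc d)) x≡)

ball-unique : ∀ r d → Unique (ball r d)
ball-unique r zero    = sphere-unique r zero
ball-unique r (suc d) = Unique.++⁺ (ball-unique r d) (sphere-unique r (suc d)) disjoint
  where
  disjoint : ∀ {x} → ¬ (x ∈ ball r d × x ∈ sphere r (suc d))
  disjoint (x∈ball , x∈sphere) = <-irrefl (to (∈-sphere (suc d)) x∈sphere) (s≤s (to (∈-ball d) x∈ball))

d<length-ball : ∀ s d → d < length (ball (2 + s) d)
d<length-ball s zero    = s≤s z≤n
d<length-ball s (suc d) = begin-strict
  suc d                                                     ≡⟨ +-comm 1 d ⟩
  d + 1                                                     <⟨ +-monoˡ-< 1 (d<length-ball s d) ⟩
  length (ball (2 + s) d) + 1                               ≤⟨ +-monoʳ-≤ _ sphere-nonempty ⟩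
  length (ball (2 + s) d) + length (sphere (2 + s) (suc d)) ≡⟨ length-++ (ball (2 + s) d) ⟨
  length (ball (2 + s) (suc d))                             ∎
  where
  open ≤-Reasoning
  sphere-nonempty : 1 ≤ length (sphere (2 + s) (suc d))
  sphere-nonempty = ≤-trans (m^n>0 (suc s) d)
    (≤-trans (m≤n*m (suc s ^ d) (2 + s)) (≤-reflexive (sym (length-sphere (2 + s) d))))

parityClass-sphere : ∀ r n → parityClass n (sphere r n) ≡ sphere r n
parityClass-sphere r n = filter-all _ (All.tabulate (cong parity ∘ to (∈-sphere n)))

parityClass-sphere-suc : ∀ r n → parityClass n (sphere r (suc n)) ≡ []
parityClass-sphere-suc r n = filter-none _ (All.tabulate λ x∈ same →
  parity≢parity-suc n (trans (sym same) (cong parity (to (∈-sphere (suc n)) x∈))))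

outerCount innerCount : ℕ → ℕ → ℕ
outerCount r d = length (parityClass d (ball r d))
innerCount r d = length (parityClass (suc d) (ball r d))

outerCount-suc : ∀ r d → outerCount r (suc d) ≡ innerCount r d + length (sphere r (suc d))
outerCount-suc r d = begin
  length (parityClass (suc d) (ball r d ++ sphere r (suc d)))
    ≡⟨ cong length (filter-++ _ (ball r d) (sphere r (suc d))) ⟩
  length (parityClass (suc d) (ball r d) ++ parityClass (suc d) (sphere r (suc d)))
    ≡⟨ length-++ (parityClass (suc d) (ball r d)) ⟩
  innerCount r d + length (parityClass (suc d) (sphere r (suc d)))
    ≡⟨ cong (λ xs → innerCount r d + length xs) (parityClass-sphere r (suc d)) ⟩
  innerCount r d + length (sphere r (suc d)) ∎
  where open ≡-Reasoning

innerCount-suc : ∀ r d → innerCount r (suc d) ≡ outerCount r d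
innerCount-suc r d = begin
  length (parityClass d (ball r d ++ sphere r (suc d)))
    ≡⟨ cong length (filter-++ _ (ball r d) (sphere r (suc d))) ⟩
  length (parityClass d (ball r d) ++ parityClass d (sphere r (suc d)))
    ≡⟨ cong (λ xs → length (parityClass d (ball r d) ++ xs)) (parityClass-sphere-suc r d) ⟩
  length (parityClass d (ball r d) ++ [])
    ≡⟨ cong length (++-identityʳ (parityClass d (ball r d))) ⟩
  outerCount r d ∎
  where open ≡-Reasoning

-- The second equation carries the size of the next sphere through the induction.
ballParityCounts : ∀ r′ d → let O = outerCount (suc r′) d; I = innerCount (suc r′) d in
  O ≡ r′ * I + 1 × r′ * O + 1 ≡ I + length (sphere (suc r′) (suc d))
ballParityCounts r′ zero =
  sym (cong (_+ 1) (*-zeroʳ r′)) , trans (+-comm (r′ * 1) 1) (sym (length-sphere (suc r′) 0))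
ballParityCounts r′ (suc d) with O≡ , O+S≡ ← ballParityCounts r′ d = O′≡ , O′+S≡
  where
  O = outerCount (suc r′) d
  I = innerCount (suc r′) d
  S = length (sphere (suc r′) (suc d))
  S′ = length (sphere (suc r′) (suc (suc d)))
  O′≡ : outerCount (suc r′) (suc d) ≡ r′ * innerCount (suc r′) (suc d) + 1
  O′≡ = begin
    outerCount (suc r′) (suc d)          ≡⟨ outerCount-suc (suc r′) d ⟩
    I + S                                ≡⟨ O+S≡ ⟨
    r′ * O + 1                           ≡⟨ cong (λ n → r′ * n + 1) (innerCount-suc (suc r′) d) ⟨
    r′ * innerCount (suc r′) (suc d) + 1 ∎
    where open ≡-Reasoning
  O′+S≡ : r′ * outerCount (suc r′) (suc d) + 1 ≡ innerCount (suc r′) (suc d) + S′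
  O′+S≡ = begin
    r′ * outerCount (suc r′) (suc d) + 1 ≡⟨ cong (λ n → r′ * n + 1) (outerCount-suc (suc r′) d) ⟩
    r′ * (I + S) + 1                     ≡⟨ distrib r′ I S ⟩
    (r′ * I + 1) + r′ * S                ≡⟨ cong₂ _+_ O≡ (length-sphere-suc r′ d) ⟨
    O + S′                               ≡⟨ cong (_+ S′) (innerCount-suc (suc r′) d) ⟨
    innerCount (suc r′) (suc d) + S′     ∎
    where
    open ≡-Reasoning
    distrib : ∀ a i s → a * (i + s) + 1 ≡ (a * i + 1) + a * s
    distrib = solve-∀

EnumeratesBall : V r → ℕ → List (V r) → Set
EnumeratesBall v d A = Unique A × (∀ x → x ∈ A ⇔ dist v x ≤ d)

ball-enumerates : ∀ r d → EnumeratesBall root d (ball r d)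
ball-enumerates r d = ball-unique r d , λ x → ∈-ball d

map-enumeratesBall : (f : Isometry r) {v : V r} {d : ℕ} {A : List (V r)} → apply f v ≡ root →
  EnumeratesBall v d A → EnumeratesBall root d (map (apply f) A)
map-enumeratesBall f {v} {d} {A} fv≡root (uA , mem) = Unique.map⁺ injective uA , λ x → mk⇔ inBall (covers x)
  where
  injective : ∀ {x y} → apply f x ≡ apply f y → x ≡ y
  injective {x} {y} eq = trans (sym (unapply-apply f x)) (trans (cong (unapply f) eq) (unapply-apply f y))
  inBall : ∀ {x} → x ∈ map (apply f) A → depth x ≤ d
  inBall x∈ with y , y∈ , refl ← ∈-map⁻ (apply f) x∈ =
    subst (_≤ d) (sym (depth-apply f fv≡root y)) (to (mem y) y∈)
  covers : ∀ x → depth x ≤ d → x ∈ map (apply f) A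
  covers x x≤d = subst (_∈ map (apply f) A) (apply-unapply f x) (∈-map⁺ (apply f) (from (mem (unapply f x))
    (subst (_≤ d) (trans (cong depth (sym (apply-unapply f x))) (depth-apply f fv≡root (unapply f x))) x≤d)))

-- 2r² times the paper's right-hand side, for r = 2 + s.
apFormula : ℕ → ℕ → ℕ
apFormula s n = ((2 + s) * (2 + s) + s * s) * (n * n) + 4 * s * n + 4

apFormula-parityCounts : ∀ s I O → O ≡ suc s * I + 1 →
  2 * ((2 + s) * (2 + s)) * (O * O + I * I) ≡ apFormula s (O + I)
apFormula-parityCounts s I _ refl = identity s I
  where
  identity : ∀ s I → let O = suc s * I + 1 in
    2 * ((2 + s) * (2 + s)) * (O * O + I * I)
      ≡ ((2 + s) * (2 + s) + s * s) * ((O + I) * (O + I)) + 4 * s * (O + I) + 4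
  identity = solve-∀

apCount-rootBall : ∀ s d {A : List (V (2 + s))} → EnumeratesBall root d A →
  2 * ((2 + s) * (2 + s)) * apCount A ≡ apFormula s (length A)
apCount-rootBall s d {A} (uA , mem) = begin
  R * apCount A           ≡⟨ cong (R *_) (apCount-convex uA convex d) ⟩
  R * (O′ * O′ + I′ * I′) ≡⟨ cong₂ (λ o i → R * (o * o + i * i)) (class-size d) (class-size (suc d)) ⟩
  R * (O * O + I * I)     ≡⟨ apFormula-parityCounts s I O (proj₁ (ballParityCounts (suc s) d)) ⟩
  apFormula s (O + I)     ≡⟨ cong (apFormula s) (cong₂ _+_ (class-size d) (class-size (suc d))) ⟨
  apFormula s (O′ + I′)   ≡⟨ cong (apFormula s) (length-parityClasses d A) ⟩
  apFormula s (length A)  ∎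
  where
  open ≡-Reasoning
  R = 2 * ((2 + s) * (2 + s))
  O′ = length (parityClass d A)
  I′ = length (parityClass (suc d) A)
  O = outerCount (2 + s) d
  I = innerCount (2 + s) d
  convex : ∀ {a c} → a ∈ A → c ∈ A → midpoint a c ∈ A
  convex {a} {c} a∈ c∈ =
    from (mem (midpoint a c)) (≤-trans (depth-midpoint a c) (⊔-lub (to (mem a) a∈) (to (mem c) c∈)))
  class-size : ∀ n → length (parityClass n A) ≡ length (parityClass n (ball (2 + s) d))
  class-size n = length-parityClass-cong n uA (ball-unique (2 + s) d)
    (λ {x} → mk⇔ (from (∈-ball d) ∘ to (mem x)) (from (mem x) ∘ to (∈-ball d)))

apCount-ball : ∀ s (v : V (2 + s)) d {A : List (V (2 + s))} → EnumeratesBall v d A →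
  2 * ((2 + s) * (2 + s)) * apCount A ≡ apFormula s (length A)
apCount-ball s v d {A} enumerates = begin
  R * apCount A                          ≡⟨ cong (R *_) (apCount-map (apply f) (dist-apply f) A) ⟨
  R * apCount (map (apply f) A)          ≡⟨ apCount-rootBall s d recentred ⟩
  apFormula s (length (map (apply f) A)) ≡⟨ cong (apFormula s) (length-map (apply f) A) ⟩
  apFormula s (length A)                 ∎
  where
  open ≡-Reasoning
  R = 2 * ((2 + s) * (2 + s))
  f = recentre v
  recentred : EnumeratesBall root d (map (apply f) A)
  recentred = map-enumeratesBall f (recentre-centre v) enumerates

ball-density : ∀ s k N → ∃[ n ] ∃[ m ] (N ≤ n × MuAtLeast (2 + s) n m ×
  suc k * ((2 + s) * (2 + s) + s * s) * (n * n)
    ≤ 2 * ((2 + s) * (2 + s)) * suc k * m + 2 * ((2 + s) * (2 + s)) * (n * n))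
ball-density s k N = n , m , <⇒≤ (d<length-ball s N) , (ballN , ball-unique (2 + s) N , refl , ≤-refl) , (begin
  suc k * c * (n * n)         ≡⟨ *-assoc (suc k) c (n * n) ⟩
  suc k * (c * (n * n))       ≤⟨ *-monoʳ-≤ (suc k) cn²≤Rm ⟩
  suc k * (R * m)             ≡⟨ rearrange (suc k) R m ⟩
  R * suc k * m               ≤⟨ m≤m+n (R * suc k * m) (R * (n * n)) ⟩
  R * suc k * m + R * (n * n) ∎)
  where
  open ≤-Reasoning
  ballN = ball (2 + s) N
  n = length ballN
  m = apCount ballN
  c = (2 + s) * (2 + s) + s * s
  R = 2 * ((2 + s) * (2 + s))
  cn²≤Rm : c * (n * n) ≤ R * m
  cn²≤Rm = begin
    c * (n * n)                 ≤⟨ m≤m+n (c * (n * n)) (4 * s * n) ⟩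
    c * (n * n) + 4 * s * n     ≤⟨ m≤m+n (c * (n * n) + 4 * s * n) 4 ⟩
    c * (n * n) + 4 * s * n + 4 ≡⟨ apCount-rootBall s N (ball-enumerates (2 + s) N) ⟨
    R * m                       ∎
  rearrange : ∀ a b x → a * (b * x) ≡ b * a * x
  rearrange = solve-∀

proposition5p1 : (r : ℕ) → 2 ≤ r →
    ((v₀ : V r) (d₀ : ℕ) (A : List (V r)) → Unique A →
      (∀ x → (x ∈ A) ⇔ (dist v₀ x ≤ d₀)) →
      2 * (r * r) * apCount A
        ≡ (r * r + (r ∸ 2) * (r ∸ 2)) * (length A * length A)
          + 4 * (r ∸ 2) * length A + 4)
    × ((k N : ℕ) → ∃[ n ] ∃[ m ] (N ≤ n × MuAtLeast r n m ×
        suc k * (r * r + (r ∸ 2) * (r ∸ 2)) * (n * n)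
          ≤ 2 * (r * r) * suc k * m + 2 * (r * r) * (n * n)))
proposition5p1 (suc (suc s)) (s≤s (s≤s _)) =
  (λ v₀ d₀ A uA mem → apCount-ball s v₀ d₀ (uA , mem)) , ball-density s
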